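{- Let $m,n\geq 2$. The set of matrices $B_{m,n}=\{\boldsymbol{u}\boldsymbol{u}' :\ \boldsymbol{u}\in U(m),\ \boldsymbol{u}'\in U(n)\}$ is an orthogonal basis of the vector space $\mathrm{V}_{m,n}$.
   Context: $\mathrm{V}_{m,n}$ is the subspace of real $m\times n$ matrices $(x_{ij})$ all of whose row sums and column sums are zero: $\sum_{k=1}^n x_{ik}=0$ for all $i$ and $\sum_{k=1}^m x_{kj}=0$ for all $j$. Matrices are regarded as vectors in $\mathbb{R}^{mn}$ with the entrywise (Frobenius) dot product. For $\boldsymbol{a}=(a_0,\dots,a_{m-1})$ and $\boldsymbol{b}=(b_0,\dots,b_{n-1})$, the outer product $\boldsymbol{a}\boldsymbol{b}$ is the $m\times n$ matrix whose $(i,j)$ entry is $a_ib_j$. Definition of $\boldsymbol{w}(k)$ for integers $k\geq 2$: $\boldsymbol{w}(k)=(w(k)_0,\dots,w(k)_{k-1})$, where: if $k$ is odd, $w(k)_i=(k-1)/2$ for $i$ even and $w(k)_i=-(k+1)/2$ for $i$ odd; $\boldsymbol{w}(2)=(1,-1)$; $\boldsymbol{w}(4)=(1,-1,-1,1)$; if $k=2m'$ is even with $k>4$, $w(k)_i=w(m')_{i \bmod m'}$ for $0\le i\le k-1$. (E.g. $\boldsymbol{w}(3)=(1,-2,1)$, $\boldsymbol{w}(5)=(2,-3,2,-3,2)$, $\boldsymbol{w}(6)=(1,-2,1,1,-2,1)$.) Definition of $U(n)$ for $n\ge 2$: build a rooted, vector-labeled binary tree $T_n$. The root is labeled $\boldsymbol{w}(n)\in\mathbb{R}^n$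 (coordinates indexed $0,\dots,n-1$). For a vertex with label $\boldsymbol{u}=(u_0,\dots,u_{n-1})$, let $i_0<\dots<i_{a'-1}$ be the indices $i$ with $u_i>0$ and $j_0<\dots<j_{a''-1}$ those with $u_j<0$. If $a'\ge2$, the vertex gets a left child labeled $\boldsymbol{u}'$ with $u'_{i_r}=w(a')_r$ ($0\le r\le a'-1$) and $u'_i=0$ for all other $i$. If $a''\ge 2$, it gets a right child labeled $\boldsymbol{u}''$ with $u''_{j_r}=w(a'')_r$ ($0\le r\le a''-1$) and $u''_i=0$ otherwise. If $a'=a''=1$ the vertex is a leaf. Then $U(n)=\{\boldsymbol{u}^1,\dots,\boldsymbol{u}^{n-1}\}$, where $\boldsymbol{u}^i$ is the label of the $i$-th vertex visited in a depth-first (preorder) traversal of $T_n$ that visits the left child before the right child.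
   Formalization: The space $\mathrm{V}_{m,n}$ is taken over the rationals rather than the reals, so its matrices have rational entries and linear independence and spanning use rational coefficients. -}

module Defs where

open import Data.Bool using (Bool; true; false; if_then_else_; _∧_)
open import Data.Nat as ℕ using (ℕ; zero; suc; _%_; _≡ᵇ_; _≤ᵇ_)
open import Data.Integer as ℤ using (ℤ; +_; -[1+_]; -_)
open import Data.List using (List; []; _∷_; _++_; [_]; map; upTo; length; filterᵇ)
open import Data.Fin using (Fin; toℕ)
open import Data.Product using (Σ; _×_)
open import Relation.Binary.PropositionalEquality using (_≡_; _≢_)
open import Data.Rational as ℚ using (ℚ; 0ℚ; _+_; _*_)

oddW : ℕ → List ℤ
oddW k = map (λ i → if i % 2 ≡ᵇ 0 then + ((k ℕ.∸ 1) ℕ./ 2) else - (+ ((k ℕ.+ 1) ℕ./ 2)))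
             (upTo k)

-- wF fuel k : the recursion for w(k); the fuel only guarantees termination
-- (fuel = k is always sufficient since k halves at each recursive call).
wF : ℕ → ℕ → List ℤ
wF _ 2 = + 1 ∷ - (+ 1) ∷ []
wF _ 4 = + 1 ∷ - (+ 1) ∷ - (+ 1) ∷ + 1 ∷ []
wF zero k = []
wF (suc f) k =
  if k % 2 ≡ᵇ 1
  then oddW k
  else (wF f (k ℕ./ 2) ++ wF f (k ℕ./ 2))

w : ℕ → List ℤ
w k = wF k k

isPos : ℤ → Bool
isPos (+ suc _) = true
isPos _         = false

isNeg : ℤ → Bool
isNeg -[1+ _ ] = true
isNeg _        = false

-- embed p u ws : the vector whose entry at the r-th index i (in increasing
-- order) with p (u_i) = true is ws_r, and 0 at all other indices.
embed : (ℤ → Bool) → List ℤ → List ℤ → List ℤ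
embed p []       ws       = []
embed p (x ∷ xs) ws with p x
embed p (x ∷ xs) []       | true  = + 0 ∷ embed p xs []
embed p (x ∷ xs) (y ∷ ys) | true  = y ∷ embed p xs ys
embed p (x ∷ xs) ws       | false = + 0 ∷ embed p xs ws

-- Preorder (left before right) list of labels of the subtree of T_n rooted at
-- a vertex with label u.  Fuel bounds the depth (depth < n always suffices,
-- since the support strictly shrinks along each edge).
preorder : ℕ → List ℤ → List (List ℤ)
preorder zero    u = [ u ]
preorder (suc f) u = u ∷ (left ++ right)
  where
  a′  = length (filterᵇ isPos u)
  a″  = length (filterᵇ isNeg u)
  left  = if 2 ≤ᵇ a′ then preorder f (embed isPos u (w a′)) else []
  right = if 2 ≤ᵇ a″ then preorder f (embed isNeg u (w a″)) else []

U : ℕ → List (List ℤ)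
U n = preorder n (w n)

Mat : ℕ → ℕ → Set
Mat m n = Fin m → Fin n → ℚ

∑ : {k : ℕ} → (Fin k → ℚ) → ℚ
∑ {zero}  f = 0ℚ
∑ {suc k} f = f Fin.zero + ∑ (λ i → f (Fin.suc i))
  where import Data.Fin as Fin

-- entry i of a list (0 outside its range)
at : List ℤ → ℕ → ℤ
at []       _       = + 0
at (x ∷ xs) zero    = x
at (x ∷ xs) (suc i) = at xs i

outer : {m n : ℕ} → List ℤ → List ℤ → Mat m n
outer a b i j = (at a (toℕ i) ℤ.* at b (toℕ j)) ℚ./ 1

InV : {m n : ℕ} → Mat m n → Set
InV {m} {n} M = ((i : Fin m) → ∑ (λ j → M i j) ≡ 0ℚ)
              × ((j : Fin n) → ∑ (λ i → M i j) ≡ 0ℚ)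

dot : {m n : ℕ} → Mat m n → Mat m n → ℚ
dot M N = ∑ (λ i → ∑ (λ j → M i j * N i j))

lincomb : {m n k : ℕ} → (Fin k → ℚ) → (Fin k → Mat m n) → Mat m n
lincomb c B i j = ∑ (λ t → c t * B t i j)

IsOrthogonalBasisOfV : {m n k : ℕ} → (Fin k → Mat m n) → Set
IsOrthogonalBasisOfV {m} {n} {k} B =
    ((t : Fin k) → InV (B t))
  × ((s t : Fin k) → s ≢ t → dot (B s) (B t) ≡ 0ℚ)
  × ((c : Fin k → ℚ) → ((i : Fin m) (j : Fin n) → lincomb c B i j ≡ 0ℚ)
                     → (t : Fin k) → c t ≡ 0ℚ)
  × ((M : Mat m n) → InV M → Σ (Fin k → ℚ) λ c →
        (i : Fin m) (j : Fin n) → M i j ≡ lincomb c B i j)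

lookupL : (xs : List (List ℤ)) → Fin (length xs) → List ℤ
lookupL (x ∷ xs) Fin.zero    = x
  where import Data.Fin as Fin
lookupL (x ∷ xs) (Fin.suc i) = lookupL xs i
  where import Data.Fin as Fin

pairIndex : (a b : ℕ) → Fin (a ℕ.* b) → Fin a × Fin b
pairIndex a b t = Data.Fin.remQuot b t
  where import Data.Fin

Bmn : (m n : ℕ) → Fin (length (U m) ℕ.* length (U n)) → Mat m n
Bmn m n t = outer (lookupL (U m) (proj₁ p)) (lookupL (U n) (proj₂ p))
  where
  open import Data.Product using (proj₁; proj₂)
  p = pairIndex (length (U m)) (length (U n)) t

{-# OPTIONS --safe #-}
-- The labels of T_n form an orthogonal basis of the zero-sum hyperplane of ℚⁿ. A label takes one
-- positive value on a set P, one negative value on a set N, vanishes elsewhere and sums to zero.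
-- Its children are zero-sum vectors supported in P and in N, where the label is constant, so by
-- induction all labels are pairwise orthogonal. Conversely, if x sums to zero on P ∪ N and is
-- orthogonal to the label, then, since the two values differ, x sums to zero on P and on N
-- separately; recursing into the children (a class of size one is a leaf) forces x = 0 on P ∪ N.
-- Finally, outer products of orthogonal bases of the zero-sum hyperplanes of ℚᵐ and ℚⁿ form an
-- orthogonal basis of V_{m,n}.
module Submission where

open import Defs

open import Algebra.Bundles using (CommutativeRing)
open import Data.Bool using (Bool; true; false; if_then_else_; T)
open import Data.Empty using (⊥-elim)
open import Data.Fin as Fin using (Fin; toℕ; zero; suc)
import Data.Fin.Properties as Finₚ
open import Data.Integer as ℤ using (ℤ; +_; -[1+_])
import Data.Integer.Properties as ℤ
open import Data.List using (List; []; _∷_; _++_; map; applyUpTo; length; filterᵇ; foldr)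
import Data.List.Properties as List
open import Data.List.Relation.Unary.All as All using (All; []; _∷_)
import Data.List.Relation.Unary.All.Properties as All
open import Data.List.Relation.Unary.AllPairs using (AllPairs; []; _∷_)
import Data.List.Relation.Unary.AllPairs.Properties as AllPairs
open import Data.Nat as ℕ using (ℕ; zero; suc; _≤_; _≥_; z≤n; s≤s; _%_; _/_; _≡ᵇ_; _≤ᵇ_)
import Data.Nat.Coprimality as Coprimality
open import Data.Nat.DivMod using (m*n/n≡m)
import Data.Nat.Properties as ℕ
open import Data.Product using (Σ; _×_; _,_; proj₁; proj₂)
open import Data.Rational as ℚ using (ℚ; 0ℚ; 1ℚ; mkℚ; _+_; _*_; _-_)
import Data.Rational.Properties as ℚ
open import Data.Sum using (_⊎_; inj₁; inj₂; [_,_]′)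
open import Data.Unit using (tt)
open import Function using (_∘_)
open import Relation.Binary.PropositionalEquality hiding (preorder)
open import Relation.Nullary using (yes; no)
open import Relation.Nullary.Decidable using (T?)
open ≡-Reasoning

import Algebra.Properties.CommutativeSemigroup (CommutativeRing.*-commutativeSemigroup ℚ.+-*-commutativeRing) as ℚ-*
import Algebra.Properties.Group ℚ.+-0-group as ℚ-Group
import Algebra.Properties.Ring ℚ.+-*-ring as ℚ-Ring
import Algebra.Properties.Semiring.Sum (CommutativeRing.semiring ℚ.+-*-commutativeRing) as Sum
import Data.Integer.Solver as ℤ-Solver
import Data.Rational.Solver as ℚ-Solver

toℚ : ℤ → ℚ
toℚ z = z ℚ./ 1

toℚ≡mkℚ : ∀ z → toℚ z ≡ mkℚ z 0 (Coprimality.sym (Coprimality.1-coprimeTo ℤ.∣ z ∣))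
toℚ≡mkℚ z = ℚ.↥p/↧p≡p _

toℚ-+ : ∀ x y → toℚ (x ℤ.+ y) ≡ toℚ x + toℚ y
toℚ-+ x y rewrite toℚ≡mkℚ x | toℚ≡mkℚ y =
  cong₂ (λ a b → (a ℤ.+ b) ℚ./ 1) (sym (ℤ.*-identityʳ x)) (sym (ℤ.*-identityʳ y))

toℚ-* : ∀ x y → toℚ (x ℤ.* y) ≡ toℚ x * toℚ y
toℚ-* x y rewrite toℚ≡mkℚ x | toℚ≡mkℚ y = refl

toℚ-injective : ∀ {x y} → toℚ x ≡ toℚ y → x ≡ y
toℚ-injective {x} {y} eq = cong ℚ.↥_ (trans (sym (toℚ≡mkℚ x)) (trans eq (toℚ≡mkℚ y)))

p*q≡0⇒p≡0 : ∀ p q → q ≢ 0ℚ → p * q ≡ 0ℚ → p ≡ 0ℚ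
p*q≡0⇒p≡0 p q q≢0 pq≡0 = begin
  p                 ≡⟨ ℚ.*-identityʳ p ⟨
  p * 1ℚ            ≡⟨ cong (p *_) (ℚ.*-inverseʳ q) ⟨
  p * (q * ℚ.1/ q)  ≡⟨ ℚ.*-assoc p q (ℚ.1/ q) ⟨
  (p * q) * ℚ.1/ q  ≡⟨ cong (_* ℚ.1/ q) pq≡0 ⟩
  0ℚ * ℚ.1/ q       ≡⟨ ℚ.*-zeroˡ (ℚ.1/ q) ⟩
  0ℚ                ∎
  where instance _ = ℚ.≢-nonZero q≢0

∑≡sum : ∀ {k} (f : Fin k → ℚ) → ∑ f ≡ Sum.sum f
∑≡sum {zero}  f = refl
∑≡sum {suc k} f = cong (_+_ (f zero)) (∑≡sum (f ∘ suc))

∑-cong : ∀ {k} {f g : Fin k → ℚ} → (∀ i → f i ≡ g i) → ∑ f ≡ ∑ g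
∑-cong {f = f} {g} f≗g = trans (∑≡sum f) (trans (Sum.sum-cong-≗ f≗g) (sym (∑≡sum g)))

∑-zero : ∀ {k} {f : Fin k → ℚ} → (∀ i → f i ≡ 0ℚ) → ∑ f ≡ 0ℚ
∑-zero {k} f≗0 = trans (∑-cong f≗0) (trans (∑≡sum {k} (λ _ → 0ℚ)) (Sum.sum-replicate-zero k))

∑-distrib-+ : ∀ {k} (f g : Fin k → ℚ) → ∑ (λ i → f i + g i) ≡ ∑ f + ∑ g
∑-distrib-+ f g = begin
  ∑ (λ i → f i + g i)          ≡⟨ ∑≡sum (λ i → f i + g i) ⟩
  Sum.sum (λ i → f i + g i)    ≡⟨ Sum.∑-distrib-+ f g ⟩
  Sum.sum f + Sum.sum g        ≡⟨ cong₂ _+_ (∑≡sum f) (∑≡sum g) ⟨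
  ∑ f + ∑ g                    ∎

*-distribˡ-∑ : ∀ {k} c (f : Fin k → ℚ) → c * ∑ f ≡ ∑ (λ i → c * f i)
*-distribˡ-∑ c f = begin
  c * ∑ f                      ≡⟨ cong (c *_) (∑≡sum f) ⟩
  c * Sum.sum f                ≡⟨ Sum.*-distribˡ-sum c f ⟩
  Sum.sum (λ i → c * f i)      ≡⟨ ∑≡sum (λ i → c * f i) ⟨
  ∑ (λ i → c * f i)            ∎

*-distribʳ-∑ : ∀ {k} c (f : Fin k → ℚ) → ∑ f * c ≡ ∑ (λ i → f i * c)
*-distribʳ-∑ c f = begin
  ∑ f * c                      ≡⟨ cong (_* c) (∑≡sum f) ⟩
  Sum.sum f * c                ≡⟨ Sum.*-distribʳ-sum c f ⟩
  Sum.sum (λ i → f i * c)      ≡⟨ ∑≡sum (λ i → f i * c) ⟨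
  ∑ (λ i → f i * c)            ∎

∑∑≡sum∑sum : ∀ {k l} (f : Fin k → Fin l → ℚ) → ∑ (λ i → ∑ (f i)) ≡ Sum.sum (λ i → Sum.sum (f i))
∑∑≡sum∑sum f = trans (∑-cong (∑≡sum ∘ f)) (∑≡sum (Sum.sum ∘ f))

∑-comm : ∀ {k l} (f : Fin k → Fin l → ℚ) → ∑ (λ i → ∑ (λ j → f i j)) ≡ ∑ (λ j → ∑ (λ i → f i j))
∑-comm f = begin
  ∑ (λ i → ∑ (f i))                          ≡⟨ ∑∑≡sum∑sum f ⟩
  Sum.sum (λ i → Sum.sum (f i))              ≡⟨ Sum.∑-comm f ⟩
  Sum.sum (λ j → Sum.sum (λ i → f i j))      ≡⟨ ∑∑≡sum∑sum (λ j i → f i j) ⟨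
  ∑ (λ j → ∑ (λ i → f i j))                  ∎

∑-product : ∀ {m n} (f : Fin m → ℚ) (g : Fin n → ℚ) → ∑ (λ i → ∑ (λ j → f i * g j)) ≡ ∑ f * ∑ g
∑-product f g = begin
  ∑ (λ i → ∑ (λ j → f i * g j))  ≡⟨ ∑-cong (λ i → *-distribˡ-∑ (f i) g) ⟨
  ∑ (λ i → f i * ∑ g)            ≡⟨ *-distribʳ-∑ (∑ g) f ⟨
  ∑ f * ∑ g                      ∎

∑-neg : ∀ {k} (f : Fin k → ℚ) → ∑ (λ i → ℚ.- f i) ≡ ℚ.- ∑ f
∑-neg {zero}  f = refl
∑-neg {suc k} f =
  trans (cong (_+_ (ℚ.- f zero)) (∑-neg (f ∘ suc))) (sym (ℚ.neg-distrib-+ (f zero) (∑ (f ∘ suc))))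

∑-distrib-- : ∀ {k} (f g : Fin k → ℚ) → ∑ (λ i → f i - g i) ≡ ∑ f - ∑ g
∑-distrib-- f g = trans (∑-distrib-+ f (ℚ.-_ ∘ g)) (cong (_+_ (∑ f)) (∑-neg g))

∑-delta : ∀ {k} (f : Fin k → ℚ) t → (∀ s → s ≢ t → f s ≡ 0ℚ) → ∑ f ≡ f t
∑-delta f zero    f≡0 = trans (cong (_+_ (f zero)) (∑-zero (λ s → f≡0 (suc s) λ ()))) (ℚ.+-identityʳ (f zero))
∑-delta f (suc t) f≡0 = begin
  f zero + ∑ (f ∘ suc)  ≡⟨ cong (_+ ∑ (f ∘ suc)) (f≡0 zero λ ()) ⟩
  0ℚ + ∑ (f ∘ suc)      ≡⟨ ℚ.+-identityˡ (∑ (f ∘ suc)) ⟩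
  ∑ (f ∘ suc)           ≡⟨ ∑-delta (f ∘ suc) t (λ s → f≡0 (suc s) ∘ (_∘ Finₚ.suc-injective)) ⟩
  f (suc t)             ∎

infix 7 _·_
_·_ : ∀ {n} → (Fin n → ℚ) → (Fin n → ℚ) → ℚ
x · y = ∑ (λ i → x i * y i)

module _ {n : ℕ} where

  ·-comm : (x y : Fin n → ℚ) → x · y ≡ y · x
  ·-comm x y = ∑-cong (λ i → ℚ.*-comm (x i) (y i))

  ·-congˡ : ∀ {x x′ : Fin n → ℚ} (y : Fin n → ℚ) → (∀ i → x i ≡ x′ i) → x · y ≡ x′ · y
  ·-congˡ y x≗x′ = ∑-cong (λ i → cong (_* y i) (x≗x′ i))

  ·-distribʳ-+ : (x x′ y : Fin n → ℚ) → (λ i → x i + x′ i) · y ≡ x · y + x′ · y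
  ·-distribʳ-+ x x′ y = trans (∑-cong (λ i → ℚ.*-distribʳ-+ (y i) (x i) (x′ i)))
                              (∑-distrib-+ (λ i → x i * y i) (λ i → x′ i * y i))

  ·-*ˡ : ∀ c (x y : Fin n → ℚ) → (λ i → c * x i) · y ≡ c * (x · y)
  ·-*ˡ c x y = trans (∑-cong (λ i → ℚ.*-assoc c (x i) (y i))) (sym (*-distribˡ-∑ c (λ i → x i * y i)))

  ·-disjoint : (x y : Fin n → ℚ) → (∀ i → x i ≡ 0ℚ ⊎ y i ≡ 0ℚ) → x · y ≡ 0ℚ
  ·-disjoint x y disjoint = ∑-zero product≡0
    where
    product≡0 : ∀ i → x i * y i ≡ 0ℚ
    product≡0 i with disjoint i
    ... | inj₁ x≡0 = trans (cong (_* y i) x≡0) (ℚ.*-zeroˡ (y i))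
    ... | inj₂ y≡0 = trans (cong (x i *_) y≡0) (ℚ.*-zeroʳ (x i))

  ·-constant-on-support : ∀ c (x y : Fin n → ℚ) → (∀ i → y i ≡ 0ℚ ⊎ x i ≡ c) → ∑ y ≡ 0ℚ →
                          x · y ≡ 0ℚ
  ·-constant-on-support c x y constant ∑y≡0 = begin
    x · y              ≡⟨ ∑-cong product≡ ⟩
    ∑ (λ i → c * y i)  ≡⟨ *-distribˡ-∑ c y ⟨
    c * ∑ y            ≡⟨ cong (c *_) ∑y≡0 ⟩
    c * 0ℚ             ≡⟨ ℚ.*-zeroʳ c ⟩
    0ℚ                 ∎
    where
    product≡ : ∀ i → x i * y i ≡ c * y i
    product≡ i with constant i
    ... | inj₁ y≡0 rewrite y≡0 = trans (ℚ.*-zeroʳ (x i)) (sym (ℚ.*-zeroʳ c))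
    ... | inj₂ x≡c = cong (_* y i) x≡c

two-level-solve : ∀ c d P N → c ≢ d → P + N ≡ 0ℚ → c * P + d * N ≡ 0ℚ → P ≡ 0ℚ × N ≡ 0ℚ
two-level-solve c d P N c≢d P+N≡0 cP+dN≡0 = P≡0 , N≡0
  where
  open ℚ-Solver.+-*-Solver
  P[c-d]≡0 : P * (c - d) ≡ 0ℚ
  P[c-d]≡0 = begin
    P * (c - d)
      ≡⟨ solve 4 (λ c d P N → P :* (c :- d) := (c :* P :+ d :* N) :- d :* (P :+ N)) refl c d P N ⟩
    (c * P + d * N) - d * (P + N)    ≡⟨ cong₂ (λ s t → s - d * t) cP+dN≡0 P+N≡0 ⟩
    0ℚ - d * 0ℚ                      ≡⟨ cong (0ℚ -_) (ℚ.*-zeroʳ d) ⟩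
    0ℚ                               ∎
  P≡0 : P ≡ 0ℚ
  P≡0 = p*q≡0⇒p≡0 P (c - d) (c≢d ∘ ℚ-Group.x∙y⁻¹≈ε⇒x≈y c d) P[c-d]≡0
  N≡0 : N ≡ 0ℚ
  N≡0 = trans (sym (ℚ.+-identityˡ N)) (trans (cong (_+ N) (sym P≡0)) P+N≡0)

-- Orthogonal bases of V_{m,n}

InV-- : ∀ {m n} {M N : Mat m n} → InV M → InV N → InV (λ i j → M i j - N i j)
InV-- {M = M} {N} (M-rows , M-cols) (N-rows , N-cols) =
  (λ i → trans (∑-distrib-- (M i) (N i)) (cong₂ _-_ (M-rows i) (N-rows i))) ,
  (λ j → trans (∑-distrib-- (λ i → M i j) (λ i → N i j)) (cong₂ _-_ (M-cols j) (N-cols j)))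

lincomb-InV : ∀ {m n k} (c : Fin k → ℚ) {B : Fin k → Mat m n} → (∀ t → InV (B t)) → InV (lincomb c B)
lincomb-InV c {B} B∈V = (λ i → lines (λ t j → B t i j) (λ t → proj₁ (B∈V t) i)) ,
                        (λ j → lines (λ t i → B t i j) (λ t → proj₂ (B∈V t) j))
  where
  lines : ∀ {l} (x : Fin _ → Fin l → ℚ) → (∀ t → ∑ (x t) ≡ 0ℚ) →
          ∑ (λ i → ∑ (λ t → c t * x t i)) ≡ 0ℚ
  lines x x≡0 = trans (∑-comm (λ i t → c t * x t i))
    (∑-zero (λ t → trans (sym (*-distribˡ-∑ (c t) (x t))) (trans (cong (c t *_) (x≡0 t)) (ℚ.*-zeroʳ (c t)))))

dot-distrib-- : ∀ {m n} (M N C : Mat m n) → dot (λ i j → M i j - N i j) C ≡ dot M C - dot N C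
dot-distrib-- M N C = begin
  ∑ (λ i → ∑ (λ j → (M i j - N i j) * C i j))
    ≡⟨ ∑-cong (λ i → ∑-cong (λ j → ℚ-Ring.[y-z]x≈yx-zx (C i j) (M i j) (N i j))) ⟩
  ∑ (λ i → ∑ (λ j → M i j * C i j - N i j * C i j))
    ≡⟨ ∑-cong (λ i → ∑-distrib-- (λ j → M i j * C i j) (λ j → N i j * C i j)) ⟩
  ∑ (λ i → ∑ (λ j → M i j * C i j) - ∑ (λ j → N i j * C i j))
    ≡⟨ ∑-distrib-- (λ i → ∑ (λ j → M i j * C i j)) (λ i → ∑ (λ j → N i j * C i j)) ⟩
  dot M C - dot N C
    ∎

dot-lincomb : ∀ {m n k} (c : Fin k → ℚ) (B : Fin k → Mat m n) (C : Mat m n) →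
              dot (lincomb c B) C ≡ ∑ (λ t → c t * dot (B t) C)
dot-lincomb c B C = begin
  ∑ (λ i → ∑ (λ j → ∑ (λ t → c t * B t i j) * C i j))
    ≡⟨ ∑-cong (λ i → ∑-cong (λ j → *-distribʳ-∑ (C i j) (λ t → c t * B t i j))) ⟩
  ∑ (λ i → ∑ (λ j → ∑ (λ t → c t * B t i j * C i j)))
    ≡⟨ ∑-cong (λ i → ∑-comm (λ j t → c t * B t i j * C i j)) ⟩
  ∑ (λ i → ∑ (λ t → ∑ (λ j → c t * B t i j * C i j)))
    ≡⟨ ∑-comm (λ i t → ∑ (λ j → c t * B t i j * C i j)) ⟩
  ∑ (λ t → ∑ (λ i → ∑ (λ j → c t * B t i j * C i j)))
    ≡⟨ ∑-cong (λ t → ∑-cong (λ i → ∑-cong (λ j → ℚ.*-assoc (c t) (B t i j) (C i j)))) ⟩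
  ∑ (λ t → ∑ (λ i → ∑ (λ j → c t * (B t i j * C i j))))
    ≡⟨ ∑-cong (λ t → pull-out (c t) (λ i j → B t i j * C i j)) ⟨
  ∑ (λ t → c t * dot (B t) C)
    ∎
  where
  pull-out : ∀ x (f : Mat _ _) → x * ∑ (λ i → ∑ (f i)) ≡ ∑ (λ i → ∑ (λ j → x * f i j))
  pull-out x f = trans (*-distribˡ-∑ x (λ i → ∑ (f i))) (∑-cong (λ i → *-distribˡ-∑ x (f i)))

module _ {m n k : ℕ} {B : Fin k → Mat m n}
         (B∈V : ∀ t → InV (B t))
         (B-orthogonal : ∀ s t → s ≢ t → dot (B s) (B t) ≡ 0ℚ)
         (B-nondegenerate : ∀ t → dot (B t) (B t) ≢ 0ℚ)
         where

  dot-lincomb-orthogonal : ∀ c t → dot (lincomb c B) (B t) ≡ c t * dot (B t) (B t)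
  dot-lincomb-orthogonal c t = trans (dot-lincomb c B (B t))
    (∑-delta _ t (λ s s≢t → trans (cong (c s *_) (B-orthogonal s t s≢t)) (ℚ.*-zeroʳ (c s))))

  orthogonal⇒independent : ∀ c → (∀ i j → lincomb c B i j ≡ 0ℚ) → ∀ t → c t ≡ 0ℚ
  orthogonal⇒independent c cB≡0 t =
    p*q≡0⇒p≡0 (c t) _ (B-nondegenerate t) (trans (sym (dot-lincomb-orthogonal c t)) dot≡0)
    where
    dot≡0 : dot (lincomb c B) (B t) ≡ 0ℚ
    dot≡0 = ∑-zero (λ i → ∑-zero (λ j → trans (cong (_* B t i j) (cB≡0 i j)) (ℚ.*-zeroˡ (B t i j))))

  -- M minus its orthogonal projection onto span B lies in V and is orthogonal to every B t.
  orthogonal⇒spanning : (∀ M → InV M → (∀ t → dot M (B t) ≡ 0ℚ) → ∀ i j → M i j ≡ 0ℚ) →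
                        ∀ M → InV M → Σ (Fin k → ℚ) λ c → ∀ i j → M i j ≡ lincomb c B i j
  orthogonal⇒spanning complete M M∈V = c , λ i j → ℚ-Group.x∙y⁻¹≈ε⇒x≈y _ _ (complete R R∈V R⊥B i j)
    where
    instance
      _ : ∀ {t} → ℚ.NonZero (dot (B t) (B t))
      _ = ℚ.≢-nonZero (B-nondegenerate _)
    c : Fin k → ℚ
    c t = dot M (B t) * ℚ.1/ dot (B t) (B t)
    R : Mat m n
    R i j = M i j - lincomb c B i j
    R∈V : InV R
    R∈V = InV-- M∈V (lincomb-InV c B∈V)
    dot-cB : ∀ t → dot (lincomb c B) (B t) ≡ dot M (B t)
    dot-cB t = begin
      dot (lincomb c B) (B t)            ≡⟨ dot-lincomb-orthogonal c t ⟩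
      Mt * ℚ.1/ Bt * Bt                  ≡⟨ ℚ.*-assoc Mt (ℚ.1/ Bt) Bt ⟩
      Mt * (ℚ.1/ Bt * Bt)                ≡⟨ cong (Mt *_) (ℚ.*-inverseˡ Bt) ⟩
      Mt * 1ℚ                            ≡⟨ ℚ.*-identityʳ Mt ⟩
      Mt                                 ∎
      where
      Mt Bt : ℚ
      Mt = dot M (B t)
      Bt = dot (B t) (B t)
    R⊥B : ∀ t → dot R (B t) ≡ 0ℚ
    R⊥B t = trans (dot-distrib-- M (lincomb c B) (B t)) (ℚ-Group.x≈y⇒x∙y⁻¹≈ε (sym (dot-cB t)))

  orthogonal⇒isOrthogonalBasisOfV : (∀ M → InV M → (∀ t → dot M (B t) ≡ 0ℚ) → ∀ i j → M i j ≡ 0ℚ) →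
                                     IsOrthogonalBasisOfV B
  orthogonal⇒isOrthogonalBasisOfV complete =
    B∈V , B-orthogonal , orthogonal⇒independent , orthogonal⇒spanning complete

-- Over a field, `complete` says that the family spans the zero-sum hyperplane.
record IsOrthogonalBasisOfSumZero {n k : ℕ} (a : Fin k → Fin n → ℚ) : Set where
  field
    sum≡0         : ∀ p → ∑ (a p) ≡ 0ℚ
    orthogonal    : ∀ p q → p ≢ q → a p · a q ≡ 0ℚ
    nondegenerate : ∀ p → a p · a p ≢ 0ℚ
    complete      : ∀ x → ∑ x ≡ 0ℚ → (∀ p → a p · x ≡ 0ℚ) → ∀ i → x i ≡ 0ℚ

module _ {m n k l : ℕ} {a : Fin k → Fin m → ℚ} {b : Fin l → Fin n → ℚ}
         (a-basis : IsOrthogonalBasisOfSumZero a) (b-basis : IsOrthogonalBasisOfSumZero b)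
         (B : Fin (k ℕ.* l) → Mat m n)
         (B≡ab : ∀ t i j → B t i j ≡ a (proj₁ (Fin.remQuot {k} l t)) i * b (proj₂ (Fin.remQuot {k} l t)) j)
         where

  private
    module A = IsOrthogonalBasisOfSumZero a-basis
    module B = IsOrthogonalBasisOfSumZero b-basis

    row : Fin (k ℕ.* l) → Fin k
    col : Fin (k ℕ.* l) → Fin l
    row t = proj₁ (Fin.remQuot {k} l t)
    col t = proj₂ (Fin.remQuot {k} l t)

  outer-InV : ∀ t → InV (B t)
  outer-InV t =
    (λ i → begin
      ∑ (B t i)                          ≡⟨ ∑-cong (B≡ab t i) ⟩
      ∑ (λ j → a (row t) i * b (col t) j) ≡⟨ *-distribˡ-∑ (a (row t) i) (b (col t)) ⟨
      a (row t) i * ∑ (b (col t))        ≡⟨ cong (a (row t) i *_) (B.sum≡0 (col t)) ⟩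
      a (row t) i * 0ℚ                   ≡⟨ ℚ.*-zeroʳ (a (row t) i) ⟩
      0ℚ                                 ∎) ,
    (λ j → begin
      ∑ (λ i → B t i j)                  ≡⟨ ∑-cong (λ i → B≡ab t i j) ⟩
      ∑ (λ i → a (row t) i * b (col t) j) ≡⟨ *-distribʳ-∑ (b (col t) j) (a (row t)) ⟨
      ∑ (a (row t)) * b (col t) j        ≡⟨ cong (_* b (col t) j) (A.sum≡0 (row t)) ⟩
      0ℚ * b (col t) j                   ≡⟨ ℚ.*-zeroˡ (b (col t) j) ⟩
      0ℚ                                 ∎)

  dot-outer : ∀ s t → dot (B s) (B t) ≡ (a (row s) · a (row t)) * (b (col s) · b (col t))
  dot-outer s t = trans (∑-cong (λ i → ∑-cong (λ j → regroup i j)))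
    (∑-product (λ i → a (row s) i * a (row t) i) (λ j → b (col s) j * b (col t) j))
    where
    regroup : ∀ i j → B s i j * B t i j ≡ (a (row s) i * a (row t) i) * (b (col s) j * b (col t) j)
    regroup i j = trans (cong₂ _*_ (B≡ab s i j) (B≡ab t i j))
      (ℚ-*.interchange (a (row s) i) (b (col s) j) (a (row t) i) (b (col t) j))

  outer-orthogonal : ∀ s t → s ≢ t → dot (B s) (B t) ≡ 0ℚ
  outer-orthogonal s t s≢t with row s Fin.≟ row t
  ... | no  rows≢ = trans (dot-outer s t) (trans (cong (_* (b (col s) · b (col t))) (A.orthogonal _ _ rows≢))
                                                 (ℚ.*-zeroˡ (b (col s) · b (col t))))
  ... | yes rows≡ = trans (dot-outer s t) (trans (cong ((a (row s) · a (row t)) *_) (B.orthogonal _ _ cols≢))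
                                                 (ℚ.*-zeroʳ (a (row s) · a (row t))))
    where
    cols≢ : col s ≢ col t
    cols≢ cols≡ = s≢t (begin
      s                                   ≡⟨ Finₚ.combine-remQuot {k} l s ⟨
      Fin.combine (row s) (col s)         ≡⟨ cong₂ Fin.combine rows≡ cols≡ ⟩
      Fin.combine (row t) (col t)         ≡⟨ Finₚ.combine-remQuot {k} l t ⟩
      t                                   ∎)

  outer-nondegenerate : ∀ t → dot (B t) (B t) ≢ 0ℚ
  outer-nondegenerate t BB≡0 = A.nondegenerate (row t)
    (p*q≡0⇒p≡0 (a (row t) · a (row t)) (b (col t) · b (col t)) (B.nondegenerate (col t))
               (trans (sym (dot-outer t t)) BB≡0))

  -- Contracting M against the row vectors a p yields zero-sum vectors r p orthogonal to every b q;
  -- hence r = 0, which says each column of M is orthogonal to every a p.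
  outer-complete : ∀ M → InV M → (∀ t → dot M (B t) ≡ 0ℚ) → ∀ i j → M i j ≡ 0ℚ
  outer-complete M (M-rows , M-cols) M⊥B i j = A.complete (λ i → M i j) (M-cols j) (λ p → r≡0 p j) i
    where
    r : Fin k → Fin n → ℚ
    r p j = a p · (λ i → M i j)
    r-sum≡0 : ∀ p → ∑ (r p) ≡ 0ℚ
    r-sum≡0 p = begin
      ∑ (λ j → ∑ (λ i → a p i * M i j))   ≡⟨ ∑-comm (λ i j → a p i * M i j) ⟨
      ∑ (λ i → ∑ (λ j → a p i * M i j))   ≡⟨ ∑-cong (λ i → *-distribˡ-∑ (a p i) (M i)) ⟨
      ∑ (λ i → a p i * ∑ (M i))           ≡⟨ ∑-cong (λ i → cong (a p i *_) (M-rows i)) ⟩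
      ∑ (λ i → a p i * 0ℚ)                ≡⟨ ∑-zero (λ i → ℚ.*-zeroʳ (a p i)) ⟩
      0ℚ                                   ∎
    r⊥b : ∀ p q → b q · r p ≡ 0ℚ
    r⊥b p q = begin
      ∑ (λ j → b q j * ∑ (λ i → a p i * M i j))
        ≡⟨ ∑-cong (λ j → *-distribˡ-∑ (b q j) (λ i → a p i * M i j)) ⟩
      ∑ (λ j → ∑ (λ i → b q j * (a p i * M i j)))
        ≡⟨ ∑-comm (λ i j → b q j * (a p i * M i j)) ⟨
      ∑ (λ i → ∑ (λ j → b q j * (a p i * M i j)))
        ≡⟨ ∑-cong (λ i → ∑-cong (λ j → regroup i j)) ⟩
      dot M (B (Fin.combine p q))
        ≡⟨ M⊥B (Fin.combine p q) ⟩
      0ℚ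
        ∎
      where
      regroup : ∀ i j → b q j * (a p i * M i j) ≡ M i j * B (Fin.combine p q) i j
      regroup i j = begin
        b q j * (a p i * M i j)
          ≡⟨ ℚ-*.x∙yz≈z∙yx (b q j) (a p i) (M i j) ⟩
        M i j * (a p i * b q j)
          ≡⟨ cong (λ (pq : Fin k × Fin l) → M i j * (a (proj₁ pq) i * b (proj₂ pq) j)) (Finₚ.remQuot-combine {k} p q) ⟨
        M i j * (a (row (Fin.combine p q)) i * b (col (Fin.combine p q)) j)
          ≡⟨ cong (M i j *_) (B≡ab (Fin.combine p q) i j) ⟨
        M i j * B (Fin.combine p q) i j
          ∎
    r≡0 : ∀ p j → r p j ≡ 0ℚ
    r≡0 p = B.complete (r p) (r-sum≡0 p) (r⊥b p)

  outer-isOrthogonalBasisOfV : IsOrthogonalBasisOfV B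
  outer-isOrthogonalBasisOfV =
    orthogonal⇒isOrthogonalBasisOfV outer-InV outer-orthogonal outer-nondegenerate outer-complete

count : (ℤ → Bool) → List ℤ → ℕ
count p u = length (filterᵇ p u)

sumℤ : List ℤ → ℤ
sumℤ = foldr ℤ._+_ (+ 0)

count-++ : ∀ p xs ys → count p (xs ++ ys) ≡ count p xs ℕ.+ count p ys
count-++ p xs ys = trans (cong length (List.filter-++ (T? ∘ p) xs ys)) (List.length-++ (filterᵇ p xs))

sumℤ-++ : ∀ xs ys → sumℤ (xs ++ ys) ≡ sumℤ xs ℤ.+ sumℤ ys
sumℤ-++ []       ys = sym (ℤ.+-identityˡ (sumℤ ys))
sumℤ-++ (x ∷ xs) ys = trans (cong (ℤ._+_ x) (sumℤ-++ xs ys)) (sym (ℤ.+-assoc x (sumℤ xs) (sumℤ ys)))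

𝟙 : Bool → ℚ
𝟙 true  = 1ℚ
𝟙 false = 0ℚ

isNonZero : ℤ → Bool
isNonZero (+ zero) = false
isNonZero _        = true

⟦_⟧ : ∀ {n} → List ℤ → Fin n → ℚ
⟦ u ⟧ i = toℚ (at u (toℕ i))

indicator : ∀ {n} → (ℤ → Bool) → List ℤ → Fin n → ℚ
indicator p u i = 𝟙 (p (at u (toℕ i)))

at-All : ∀ {P : ℤ → Set} {n} u → All P u → length u ≡ n → (i : Fin n) → P (at u (toℕ i))
at-All []      []        refl ()
at-All (z ∷ u) (Pz ∷ Pu) eq   zero    = Pz
at-All (z ∷ u) (Pz ∷ Pu) eq   (suc i) = at-All u Pu (ℕ.suc-injective eq) i

∑⟦⟧ : ∀ {n} u → length u ≡ n → ∑ {n} ⟦ u ⟧ ≡ toℚ (sumℤ u)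
∑⟦⟧ {zero}  []      _ = refl
∑⟦⟧ {suc n} (z ∷ u) eq =
  trans (cong (_+_ (toℚ z)) (∑⟦⟧ u (ℕ.suc-injective eq))) (sym (toℚ-+ z (sumℤ u)))

at-map : ∀ f u i → f (+ 0) ≡ + 0 → at (map f u) i ≡ f (at u i)
at-map f []      i       f0 = sym f0
at-map f (z ∷ u) zero    f0 = refl
at-map f (z ∷ u) (suc i) f0 = at-map f u i f0

count-isPos+isNeg≤length : ∀ u → count isPos u ℕ.+ count isNeg u ≤ length u
count-isPos+isNeg≤length []              = z≤n
count-isPos+isNeg≤length (+ zero   ∷ u) = ℕ.m≤n⇒m≤1+n (count-isPos+isNeg≤length u)
count-isPos+isNeg≤length (+ suc _  ∷ u) = s≤s (count-isPos+isNeg≤length u)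
count-isPos+isNeg≤length (-[1+ _ ] ∷ u) =
  ℕ.≤-trans (ℕ.≤-reflexive (ℕ.+-suc _ _)) (s≤s (count-isPos+isNeg≤length u))

count≥1 : ∀ p u i → p (+ 0) ≡ false → p (at u i) ≡ true → 1 ≤ count p u
count≥1 p []       i       p0 pu≡ with () ← trans (sym pu≡) p0
count≥1 p (x ∷ xs) i       p0 pu≡ with p x in px
... | true = s≤s z≤n
count≥1 p (x ∷ xs) zero    p0 pu≡ | false with () ← trans (sym pu≡) px
count≥1 p (x ∷ xs) (suc i) p0 pu≡ | false = count≥1 p xs i p0 pu≡

count≤1-unique : ∀ p u i j → p (+ 0) ≡ false → count p u ≤ 1 →
                 p (at u i) ≡ true → p (at u j) ≡ true → i ≡ j
count≤1-unique p []       i       j       p0 c≤1       pi pj with () ← trans (sym pi) p0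
count≤1-unique p (x ∷ xs) i       j       p0 c≤1       pi pj with p x in px
count≤1-unique p (x ∷ xs) zero    zero    p0 c≤1       pi pj | true = refl
count≤1-unique p (x ∷ xs) zero    (suc j) p0 (s≤s c≤0) pi pj | true
  with () ← ℕ.≤-trans (count≥1 p xs j p0 pj) c≤0
count≤1-unique p (x ∷ xs) (suc i) j       p0 (s≤s c≤0) pi pj | true
  with () ← ℕ.≤-trans (count≥1 p xs i p0 pi) c≤0
count≤1-unique p (x ∷ xs) zero    j       p0 c≤1       pi pj | false with () ← trans (sym pi) px
count≤1-unique p (x ∷ xs) (suc i) zero    p0 c≤1       pi pj | false with () ← trans (sym pj) px
count≤1-unique p (x ∷ xs) (suc i) (suc j) p0 c≤1       pi pj | false =
  cong suc (count≤1-unique p xs i j p0 c≤1 pi pj)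

square : ℤ → ℤ
square z = z ℤ.* z

sumℤ-squares : ∀ u → Σ ℕ λ N → sumℤ (map square u) ≡ + N
sumℤ-squares []             = 0 , refl
sumℤ-squares (+ zero ∷ u)   = proj₁ (sumℤ-squares u) , trans (ℤ.+-identityˡ _) (proj₂ (sumℤ-squares u))
sumℤ-squares (+ suc k ∷ u)  = _ , cong (ℤ._+_ (square (+ suc k))) (proj₂ (sumℤ-squares u))
sumℤ-squares (-[1+ k ] ∷ u) = _ , cong (ℤ._+_ (square -[1+ k ])) (proj₂ (sumℤ-squares u))

sumℤ-squares-positive : ∀ u → 1 ≤ count isPos u → Σ ℕ λ N → sumℤ (map square u) ≡ + suc N
sumℤ-squares-positive (+ zero ∷ u)   1≤count =
  proj₁ (sumℤ-squares-positive u 1≤count) , trans (ℤ.+-identityˡ _) (proj₂ (sumℤ-squares-positive u 1≤count))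
sumℤ-squares-positive (+ suc k ∷ u)  _       = _ , cong (ℤ._+_ (square (+ suc k))) (proj₂ (sumℤ-squares u))
sumℤ-squares-positive (-[1+ k ] ∷ u) 1≤count =
  _ , cong (ℤ._+_ (square -[1+ k ])) (proj₂ (sumℤ-squares-positive u 1≤count))

length-embed : ∀ p u ws → length (embed p u ws) ≡ length u
length-embed p []       ws = refl
length-embed p (x ∷ xs) ws with p x
length-embed p (x ∷ xs) []       | true  = cong suc (length-embed p xs [])
length-embed p (x ∷ xs) (y ∷ ys) | true  = cong suc (length-embed p xs ys)
length-embed p (x ∷ xs) ws       | false = cong suc (length-embed p xs ws)

embed-All : ∀ {P : ℤ → Set} p u ws → P (+ 0) → All P ws → All P (embed p u ws)
embed-All p []       ws       P0 Pws = []
embed-All p (x ∷ xs) ws       P0 Pws with p x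
embed-All p (x ∷ xs) []       P0 Pws        | true  = P0 ∷ embed-All p xs [] P0 Pws
embed-All p (x ∷ xs) (y ∷ ys) P0 (Py ∷ Pys) | true  = Py ∷ embed-All p xs ys P0 Pys
embed-All p (x ∷ xs) ws       P0 Pws        | false = P0 ∷ embed-All p xs ws P0 Pws

sumℤ-embed : ∀ p u ws → length ws ≡ count p u → sumℤ (embed p u ws) ≡ sumℤ ws
sumℤ-embed p []       []       _ = refl
sumℤ-embed p (x ∷ xs) ws       ws≡ with p x
sumℤ-embed p (x ∷ xs) (y ∷ ys) ws≡ | true  = cong (ℤ._+_ y) (sumℤ-embed p xs ys (ℕ.suc-injective ws≡))
sumℤ-embed p (x ∷ xs) ws       ws≡ | false = trans (ℤ.+-identityˡ _) (sumℤ-embed p xs ws ws≡)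

count-embed : ∀ q p u ws → q (+ 0) ≡ false → length ws ≡ count p u → count q (embed p u ws) ≡ count q ws
count-embed q p []       []       q0 _ = refl
count-embed q p (x ∷ xs) ws       q0 ws≡ with p x
count-embed q p (x ∷ xs) (y ∷ ys) q0 ws≡ | true with q y
... | true  = cong suc (count-embed q p xs ys q0 (ℕ.suc-injective ws≡))
... | false = count-embed q p xs ys q0 (ℕ.suc-injective ws≡)
count-embed q p (x ∷ xs) ws       q0 ws≡ | false rewrite q0 = count-embed q p xs ws q0 ws≡

embed-outside : ∀ p u ws i → p (at u i) ≡ false → at (embed p u ws) i ≡ + 0
embed-outside p []       ws       i       _   = refl
embed-outside p (x ∷ xs) ws       i       px≡ with p x in px
embed-outside p (x ∷ xs) []       zero    px≡ | true  = refl
embed-outside p (x ∷ xs) []       (suc i) px≡ | true  = embed-outside p xs [] i px≡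
embed-outside p (x ∷ xs) (y ∷ ys) zero    px≡ | true  with () ← trans (sym px) px≡
embed-outside p (x ∷ xs) (y ∷ ys) (suc i) px≡ | true  = embed-outside p xs ys i px≡
embed-outside p (x ∷ xs) ws       zero    px≡ | false = refl
embed-outside p (x ∷ xs) ws       (suc i) px≡ | false = embed-outside p xs ws i px≡

embed-inside : ∀ {P : ℤ → Set} p u ws → p (+ 0) ≡ false → All P ws → length ws ≡ count p u →
               ∀ i → p (at u i) ≡ true → P (at (embed p u ws) i)
embed-inside p []       ws       p0 Pws        ws≡ i       pu≡ with () ← trans (sym pu≡) p0
embed-inside p (x ∷ xs) ws       p0 Pws        ws≡ i       pu≡ with p x in px
embed-inside p (x ∷ xs) (y ∷ ys) p0 (Py ∷ Pys) ws≡ zero    pu≡ | true  = Py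
embed-inside p (x ∷ xs) (y ∷ ys) p0 (Py ∷ Pys) ws≡ (suc i) pu≡ | true  =
  embed-inside p xs ys p0 Pys (ℕ.suc-injective ws≡) i pu≡
embed-inside p (x ∷ xs) ws       p0 Pws        ws≡ zero    pu≡ | false with () ← trans (sym pu≡) px
embed-inside p (x ∷ xs) ws       p0 Pws        ws≡ (suc i) pu≡ | false = embed-inside p xs ws p0 Pws ws≡ i pu≡

-- The vectors w(k)

TwoValued : ℕ → ℕ → ℤ → Set
TwoValued a b z = z ≡ + suc a ⊎ z ≡ -[1+ b ]

record Balanced (Entry : ℕ → ℕ → ℤ → Set) (n : ℕ) (u : List ℤ) : Set where
  field
    length≡ : length u ≡ n
    a b     : ℕ
    entries : All (Entry a b) u
    sum≡0   : sumℤ u ≡ + 0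
    hasPos  : 1 ≤ count isPos u
    hasNeg  : 1 ≤ count isNeg u

IsWeight : ℕ → List ℤ → Set
IsWeight = Balanced TwoValued

Level : ℕ → ℕ → ℤ → Set
Level a b z = z ≡ + 0 ⊎ TwoValued a b z

IsLabel : ℕ → List ℤ → Set
IsLabel = Balanced Level

IsWeight⇒IsLabel : ∀ {n u} → IsWeight n u → IsLabel n u
IsWeight⇒IsLabel W = record { Balanced W; entries = All.map inj₂ (Balanced.entries W) }

TwoValued⇒isNonZero : ∀ {a b z} → TwoValued a b z → isNonZero z ≡ true
TwoValued⇒isNonZero (inj₁ refl) = refl
TwoValued⇒isNonZero (inj₂ refl) = refl

Balanced-++ : ∀ {E k u} → Balanced E k u → Balanced E (k ℕ.+ k) (u ++ u)
Balanced-++ {u = u} W = record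
  { length≡ = trans (List.length-++ u) (cong₂ ℕ._+_ length≡ length≡)
  ; a = a ; b = b
  ; entries = All.++⁺ entries entries
  ; sum≡0 = trans (sumℤ-++ u u) (cong₂ ℤ._+_ sum≡0 sum≡0)
  ; hasPos = ℕ.≤-trans hasPos (ℕ.≤-trans (ℕ.m≤m+n _ _) (ℕ.≤-reflexive (sym (count-++ isPos u u))))
  ; hasNeg = ℕ.≤-trans hasNeg (ℕ.≤-trans (ℕ.m≤m+n _ _) (ℕ.≤-reflexive (sym (count-++ isNeg u u))))
  }
  where open Balanced W

alternate : ℤ → ℤ → ℕ → List ℤ
alternate x y zero    = x ∷ []
alternate x y (suc t) = x ∷ y ∷ alternate x y t

length-alternate : ∀ x y t → length (alternate x y t) ≡ suc (t ℕ.+ t)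
length-alternate x y zero    = refl
length-alternate x y (suc t) = cong (λ m → suc (suc m)) (trans (length-alternate x y t) (sym (ℕ.+-suc t t)))

sumℤ-alternate : ∀ x y t → sumℤ (alternate x y t) ≡ x ℤ.+ + t ℤ.* (x ℤ.+ y)
sumℤ-alternate x y zero    = cong (ℤ._+_ x) (sym (ℤ.*-zeroˡ (x ℤ.+ y)))
sumℤ-alternate x y (suc t) = trans (cong (λ s → x ℤ.+ (y ℤ.+ s)) (sumℤ-alternate x y t))
  (solve 3 (λ x y t → x :+ (y :+ (x :+ t :* (x :+ y))) := x :+ (con (+ 1) :+ t) :* (x :+ y)) refl x y (+ t))
  where open ℤ-Solver.+-*-Solver

alternate-isWeight : ∀ a → IsWeight (suc (suc a ℕ.+ suc a)) (alternate (+ suc a) -[1+ suc a ] (suc a))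
alternate-isWeight a = record
  { length≡ = length-alternate x y (suc a)
  ; a = a ; b = suc a
  ; entries = entries (suc a)
  ; sum≡0 = trans (sumℤ-alternate x y (suc a))
                  (solve 1 (λ J → J :+ J :* (J :+ :- (con (+ 1) :+ J)) := con (+ 0)) refl x)
  ; hasPos = s≤s z≤n
  ; hasNeg = s≤s z≤n
  }
  where
  open ℤ-Solver.+-*-Solver
  x y : ℤ
  x = + suc a
  y = -[1+ suc a ]
  entries : ∀ t → All (TwoValued a (suc a)) (alternate x y t)
  entries zero    = inj₁ refl ∷ []
  entries (suc t) = inj₁ refl ∷ inj₂ refl ∷ entries t

data ParityView : ℕ → Set where
  even : ∀ j → ParityView (j ℕ.+ j)
  odd  : ∀ j → ParityView (suc (j ℕ.+ j))

parityView : ∀ k → ParityView k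
parityView zero = even 0
parityView (suc k) with parityView k
... | even j = odd j
... | odd j  = subst ParityView (cong suc (ℕ.+-suc j j)) (even (suc j))

[j+j]%2≡0 : ∀ j → (j ℕ.+ j) % 2 ≡ 0
[j+j]%2≡0 zero    = refl
[j+j]%2≡0 (suc j) rewrite ℕ.+-suc j j = [j+j]%2≡0 j

[1+j+j]%2≡1 : ∀ j → suc (j ℕ.+ j) % 2 ≡ 1
[1+j+j]%2≡1 zero    = refl
[1+j+j]%2≡1 (suc j) rewrite ℕ.+-suc j j = [1+j+j]%2≡1 j

[j+j]/2≡j : ∀ j → (j ℕ.+ j) / 2 ≡ j
[j+j]/2≡j j = trans (cong (_/ 2) (trans (cong (j ℕ.+_) (sym (ℕ.+-identityʳ j))) (ℕ.*-comm 2 j))) (m*n/n≡m j 2)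

applyUpTo-alternate : ∀ x y t →
                      applyUpTo (λ i → if i % 2 ≡ᵇ 0 then x else y) (suc (t ℕ.+ t)) ≡ alternate x y t
applyUpTo-alternate x y zero = refl
applyUpTo-alternate x y (suc t) rewrite ℕ.+-suc t t = cong (λ l → x ∷ y ∷ l) (applyUpTo-alternate x y t)

oddW-alternate : ∀ j → oddW (suc (j ℕ.+ j)) ≡ alternate (+ j) -[1+ j ] j
oddW-alternate j = begin
  oddW k                                            ≡⟨ List.map-upTo _ k ⟩
  applyUpTo (λ i → if i % 2 ≡ᵇ 0 then x else y) k   ≡⟨ applyUpTo-alternate x y j ⟩
  alternate x y j                                   ≡⟨ cong₂ (λ h h′ → alternate (+ h) (ℤ.- (+ h′)) j) x≡ y≡ ⟩
  alternate (+ j) -[1+ j ] j                        ∎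
  where
  k : ℕ
  k = suc (j ℕ.+ j)
  x y : ℤ
  x = + ((k ℕ.∸ 1) / 2)
  y = ℤ.- (+ ((k ℕ.+ 1) / 2))
  x≡ : (k ℕ.∸ 1) / 2 ≡ j
  x≡ = [j+j]/2≡j j
  y≡ : (k ℕ.+ 1) / 2 ≡ suc j
  y≡ = trans (cong (_/ 2) (trans (ℕ.+-comm k 1) (cong suc (sym (ℕ.+-suc j j))))) ([j+j]/2≡j (suc j))

wF-step : ∀ f k → 3 ≤ k → k ≤ suc f → (∀ k′ → 2 ≤ k′ → k′ ≤ f → IsWeight k′ (wF f k′)) →
          IsWeight k (if k % 2 ≡ᵇ 1 then oddW k else (wF f (k / 2) ++ wF f (k / 2)))
wF-step f k 3≤k k≤1+f IH with parityView k
... | even j rewrite [j+j]%2≡0 j | [j+j]/2≡j j = Balanced-++ (IH j (2≤j 3≤k) (j≤f j k≤1+f))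
  where
  2≤j : ∀ {j} → 3 ≤ j ℕ.+ j → 2 ≤ j
  2≤j {suc (suc j)} _ = s≤s (s≤s z≤n)
  2≤j {suc zero} (s≤s (s≤s ()))
  j≤f : ∀ j {f} → j ℕ.+ j ≤ suc f → j ≤ f
  j≤f zero    _ = z≤n
  j≤f (suc j) {f} (s≤s j+1+j≤f) = ℕ.≤-trans (s≤s (ℕ.m≤n+m j j)) (subst (_≤ f) (ℕ.+-suc j j) j+1+j≤f)
wF-step f _ (s≤s ()) _ _ | odd zero
... | odd (suc a) rewrite [1+j+j]%2≡1 (suc a) | oddW-alternate (suc a) = alternate-isWeight a

wF-isWeight : ∀ f k → 2 ≤ k → k ≤ f → IsWeight k (wF f k)
wF-isWeight zero    (suc (suc k)) _ ()
wF-isWeight (suc f) 1 (s≤s ()) _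
wF-isWeight (suc f) 2 _ _ = record
  { length≡ = refl ; a = 0 ; b = 0 ; entries = inj₁ refl ∷ inj₂ refl ∷ []
  ; sum≡0 = refl ; hasPos = s≤s z≤n ; hasNeg = s≤s z≤n }
wF-isWeight (suc f) 3 _ 3≤1+f = wF-step f 3 ℕ.≤-refl 3≤1+f (wF-isWeight f)
wF-isWeight (suc f) 4 _ _ = record
  { length≡ = refl ; a = 0 ; b = 0 ; entries = inj₁ refl ∷ inj₂ refl ∷ inj₂ refl ∷ inj₁ refl ∷ []
  ; sum≡0 = refl ; hasPos = s≤s z≤n ; hasNeg = s≤s z≤n }
wF-isWeight (suc f) k@(suc (suc (suc (suc (suc _))))) _ k≤1+f =
  wF-step f k (s≤s (s≤s (s≤s z≤n))) k≤1+f (wF-isWeight f)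

w-isWeight : ∀ k → 2 ≤ k → IsWeight k (w k)
w-isWeight k 2≤k = wF-isWeight k k 2≤k ℕ.≤-refl

-- The tree T_n

indicator-isNonZero : ∀ {n} u (i : Fin n) → indicator isNonZero u i ≡ indicator isPos u i + indicator isNeg u i
indicator-isNonZero u i with at u (toℕ i)
... | + zero   = refl
... | + suc _  = refl
... | -[1+ _ ] = refl

level-decomposition : ∀ {a b z} → Level a b z →
                      toℚ z ≡ toℚ (+ suc a) * 𝟙 (isPos z) + toℚ -[1+ b ] * 𝟙 (isNeg z)
level-decomposition {a} {b} = decompose
  where
  open ℚ-Solver.+-*-Solver
  c d : ℚ
  c = toℚ (+ suc a)
  d = toℚ -[1+ b ]
  decompose : ∀ {z} → Level a b z → toℚ z ≡ c * 𝟙 (isPos z) + d * 𝟙 (isNeg z)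
  decompose (inj₁ refl)        = solve 2 (λ c d → con 0ℚ := c :* con 0ℚ :+ d :* con 0ℚ) refl c d
  decompose (inj₂ (inj₁ refl)) = solve 2 (λ c d → c := c :* con 1ℚ :+ d :* con 0ℚ) refl c d
  decompose (inj₂ (inj₂ refl)) = solve 2 (λ c d → d := c :* con 0ℚ :+ d :* con 1ℚ) refl c d

label-class-sums : ∀ {n u} → IsLabel n u → (x : Fin n → ℚ) →
                   indicator isNonZero u · x ≡ 0ℚ → ⟦ u ⟧ · x ≡ 0ℚ →
                   indicator isPos u · x ≡ 0ℚ × indicator isNeg u · x ≡ 0ℚ
label-class-sums {u = u} L x support·x≡0 u·x≡0 = two-level-solve c d _ _ c≢d P+N≡0 cP+dN≡0
  where
  open Balanced L
  c d : ℚ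
  c = toℚ (+ suc a)
  d = toℚ -[1+ b ]
  c≢d : c ≢ d
  c≢d c≡d with () ← toℚ-injective {+ suc a} { -[1+ b ]} c≡d
  P+N≡0 : indicator isPos u · x + indicator isNeg u · x ≡ 0ℚ
  P+N≡0 = trans (sym (·-distribʳ-+ (indicator isPos u) (indicator isNeg u) x))
                (trans (·-congˡ x (λ i → sym (indicator-isNonZero u i))) support·x≡0)
  cP+dN≡0 : c * (indicator isPos u · x) + d * (indicator isNeg u · x) ≡ 0ℚ
  cP+dN≡0 = begin
    c * (indicator isPos u · x) + d * (indicator isNeg u · x)
      ≡⟨ cong₂ _+_ (·-*ˡ c (indicator isPos u) x) (·-*ˡ d (indicator isNeg u) x) ⟨
    (λ i → c * indicator isPos u i) · x + (λ i → d * indicator isNeg u i) · x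
      ≡⟨ ·-distribʳ-+ (λ i → c * indicator isPos u i) (λ i → d * indicator isNeg u i) x ⟨
    (λ i → c * indicator isPos u i + d * indicator isNeg u i) · x
      ≡⟨ ·-congˡ x (λ i → level-decomposition (at-All u entries length≡ i)) ⟨
    ⟦ u ⟧ · x
      ≡⟨ u·x≡0 ⟩
    0ℚ ∎

child : (ℤ → Bool) → List ℤ → List ℤ
child p u = embed p u (w (count p u))

-- With this, preorder (suc f) u reduces to u ∷ (subtree isPos f u ++ subtree isNeg f u).
subtree : (ℤ → Bool) → ℕ → List ℤ → List (List ℤ)
subtree p f u = if 2 ≤ᵇ count p u then preorder f (child p u) else []

module _ (p : ℤ → Bool) (p0 : p (+ 0) ≡ false) (u : List ℤ) (2≤count : 2 ≤ count p u) where

  private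
    ws : List ℤ
    ws = w (count p u)
    module W = Balanced (w-isWeight (count p u) 2≤count)

  child-isLabel : ∀ {n} → length u ≡ n → IsLabel n (child p u)
  child-isLabel length≡ = record
    { length≡ = trans (length-embed p u ws) length≡
    ; a = W.a ; b = W.b
    ; entries = embed-All p u ws (inj₁ refl) (All.map inj₂ W.entries)
    ; sum≡0 = trans (sumℤ-embed p u ws W.length≡) W.sum≡0
    ; hasPos = subst (1 ≤_) (sym (count-embed isPos p u ws refl W.length≡)) W.hasPos
    ; hasNeg = subst (1 ≤_) (sym (count-embed isNeg p u ws refl W.length≡)) W.hasNeg
    }

  child-support : ∀ i → isNonZero (at (child p u) i) ≡ p (at u i)
  child-support i with p (at u i) in pu≡
  ... | false = cong isNonZero (embed-outside p u ws i pu≡)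
  ... | true  = embed-inside p u ws p0 (All.map TwoValued⇒isNonZero W.entries) W.length≡ i pu≡

  child-signs≤count : count isPos (child p u) ℕ.+ count isNeg (child p u) ≤ count p u
  child-signs≤count = ℕ.≤-trans
    (ℕ.≤-reflexive (cong₂ ℕ._+_ (count-embed isPos p u ws refl W.length≡)
                                (count-embed isNeg p u ws refl W.length≡)))
    (ℕ.≤-trans (count-isPos+isNeg≤length ws) (ℕ.≤-reflexive W.length≡))

subtree-All : ∀ {P : List ℤ → Set} p f u →
              (2 ≤ count p u → All P (preorder f (child p u))) → All P (subtree p f u)
subtree-All p f u h with 2 ≤ᵇ count p u in 2≤ᵇcount
... | true  = h (ℕ.≤ᵇ⇒≤ 2 (count p u) (subst T (sym 2≤ᵇcount) tt))
... | false = []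

subtree-AllPairs : ∀ {R : List ℤ → List ℤ → Set} p f u →
                   (2 ≤ count p u → AllPairs R (preorder f (child p u))) → AllPairs R (subtree p f u)
subtree-AllPairs p f u h with 2 ≤ᵇ count p u in 2≤ᵇcount
... | true  = h (ℕ.≤ᵇ⇒≤ 2 (count p u) (subst T (sym 2≤ᵇcount) tt))
... | false = []

SupportedOn : (ℤ → Bool) → List ℤ → List ℤ → Set
SupportedOn p u v = ∀ i → p (at u i) ≡ false → at v i ≡ + 0

isNonZero≡false : ∀ z → isNonZero z ≡ false → z ≡ + 0
isNonZero≡false (+ zero) _ = refl

mutual
  preorder-support : ∀ f u → All (SupportedOn isNonZero u) (preorder f u)
  preorder-support zero    u = (λ i → isNonZero≡false (at u i)) ∷ []
  preorder-support (suc f) u = (λ i → isNonZero≡false (at u i)) ∷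
    All.++⁺ (All.map (λ {v} → class⊆support isPos refl {v}) (subtree-support isPos refl f u))
            (All.map (λ {v} → class⊆support isNeg refl {v}) (subtree-support isNeg refl f u))
    where
    class⊆support : ∀ p → p (+ 0) ≡ false → ∀ {v} → SupportedOn p u v → SupportedOn isNonZero u v
    class⊆support p p0 v⊆ i nz≡false =
      v⊆ i (subst (λ z → p z ≡ false) (sym (isNonZero≡false (at u i) nz≡false)) p0)

  subtree-support : ∀ p → p (+ 0) ≡ false → ∀ f u → All (SupportedOn p u) (subtree p f u)
  subtree-support p p0 f u = subtree-All p f u λ 2≤count →
    All.map (λ v⊆child i pu≡false → v⊆child i (trans (child-support p p0 u 2≤count i) pu≡false))
            (preorder-support f (child p u))

mutual
  preorder-isLabel : ∀ {n} f u → IsLabel n u → All (IsLabel n) (preorder f u)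
  preorder-isLabel zero    u L = L ∷ []
  preorder-isLabel (suc f) u L = L ∷ All.++⁺ (subtree-isLabel isPos refl f u L) (subtree-isLabel isNeg refl f u L)

  subtree-isLabel : ∀ {n} p → p (+ 0) ≡ false → ∀ f u → IsLabel n u → All (IsLabel n) (subtree p f u)
  subtree-isLabel p p0 f u L = subtree-All p f u λ 2≤count →
    preorder-isLabel f (child p u) (child-isLabel p p0 u 2≤count (Balanced.length≡ L))

Orthogonal : ℕ → List ℤ → List ℤ → Set
Orthogonal n u v = ⟦_⟧ {n} u · ⟦ v ⟧ ≡ 0ℚ

isPos-level : ∀ {a b z} → Level a b z → isPos z ≡ true → z ≡ + suc a
isPos-level (inj₁ refl)        ()
isPos-level (inj₂ (inj₁ z≡))   _ = z≡
isPos-level (inj₂ (inj₂ refl)) ()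

isNeg-level : ∀ {a b z} → Level a b z → isNeg z ≡ true → z ≡ -[1+ b ]
isNeg-level (inj₁ refl)        ()
isNeg-level (inj₂ (inj₁ refl)) ()
isNeg-level (inj₂ (inj₂ z≡))   _ = z≡

isPos⇒¬isNeg : ∀ z → isPos z ≡ true → isNeg z ≡ false
isPos⇒¬isNeg (+ suc _) _ = refl

orthogonal-to-class : ∀ {n} p c u v → (∀ (i : Fin n) → p (at u (toℕ i)) ≡ true → at u (toℕ i) ≡ c) →
                      length v ≡ n → sumℤ v ≡ + 0 → SupportedOn p u v → Orthogonal n u v
orthogonal-to-class p c u v u≡c length≡ sum≡0 v⊆ =
  ·-constant-on-support (toℚ c) ⟦ u ⟧ ⟦ v ⟧ v≡0-or-u≡c (trans (∑⟦⟧ v length≡) (cong toℚ sum≡0))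
  where
  v≡0-or-u≡c : ∀ i → ⟦ v ⟧ i ≡ 0ℚ ⊎ ⟦ u ⟧ i ≡ toℚ c
  v≡0-or-u≡c i with p (at u (toℕ i)) in pu≡
  ... | false = inj₁ (cong toℚ (v⊆ (toℕ i) pu≡))
  ... | true  = inj₂ (cong toℚ (u≡c i pu≡))

orthogonal-across-classes : ∀ {n} u v v′ → SupportedOn isPos u v → SupportedOn isNeg u v′ → Orthogonal n v v′
orthogonal-across-classes {n} u v v′ v⊆ v′⊆ = ·-disjoint ⟦ v ⟧ ⟦ v′ ⟧ disjoint
  where
  disjoint : ∀ (i : Fin n) → ⟦ v ⟧ i ≡ 0ℚ ⊎ ⟦ v′ ⟧ i ≡ 0ℚ
  disjoint i with isPos (at u (toℕ i)) in pos
  ... | false = inj₁ (cong toℚ (v⊆ (toℕ i) pos))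
  ... | true  = inj₂ (cong toℚ (v′⊆ (toℕ i) (isPos⇒¬isNeg (at u (toℕ i)) pos)))

preorder-orthogonal : ∀ {n} f u → IsLabel n u → AllPairs (Orthogonal n) (preorder f u)
preorder-orthogonal zero    u L = [] ∷ []
preorder-orthogonal {n} (suc f) u L =
  All.++⁺ (u⊥subtree isPos refl (+ suc a) isPos-level) (u⊥subtree isNeg refl -[1+ b ] isNeg-level) ∷
  AllPairs.++⁺ (subtree-orthogonal isPos refl) (subtree-orthogonal isNeg refl) across
  where
  open Balanced L
  u⊥subtree : ∀ p → p (+ 0) ≡ false → ∀ c → (∀ {z} → Level a b z → p z ≡ true → z ≡ c) →
              All (Orthogonal n u) (subtree p f u)
  u⊥subtree p p0 c level≡c = All.zipWith
    (λ {v} (Lv , v⊆) → orthogonal-to-class p c u v (λ i → level≡c (at-All u entries length≡ i))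
                                       (Balanced.length≡ Lv) (Balanced.sum≡0 Lv) v⊆)
    (subtree-isLabel p p0 f u L , subtree-support p p0 f u)
  subtree-orthogonal : ∀ p → p (+ 0) ≡ false → AllPairs (Orthogonal n) (subtree p f u)
  subtree-orthogonal p p0 = subtree-AllPairs p f u λ 2≤count →
    preorder-orthogonal f (child p u) (child-isLabel p p0 u 2≤count length≡)
  across : All (λ v → All (Orthogonal n v) (subtree isNeg f u)) (subtree isPos f u)
  across = All.map (λ {v} v⊆ → All.map (λ {v′} → orthogonal-across-classes {n} u v v′ v⊆)
                                        (subtree-support isNeg refl f u))
                   (subtree-support isPos refl f u)

sign-split : ∀ z → isNonZero z ≡ true → isPos z ≡ true ⊎ isNeg z ≡ true
sign-split (+ suc _)  _ = inj₁ refl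
sign-split -[1+ _ ]   _ = inj₂ refl

indicator-singleton : ∀ {n} p u → p (+ 0) ≡ false → count p u ≤ 1 → (x : Fin n → ℚ) →
                      ∀ i → p (at u (toℕ i)) ≡ true → indicator p u · x ≡ x i
indicator-singleton p u p0 count≤1 x i pu≡ = begin
  indicator p u · x           ≡⟨ ∑-delta (λ s → indicator p u s * x s) i vanish ⟩
  𝟙 (p (at u (toℕ i))) * x i  ≡⟨ cong (λ β → 𝟙 β * x i) pu≡ ⟩
  1ℚ * x i                    ≡⟨ ℚ.*-identityˡ (x i) ⟩
  x i                         ∎
  where
  vanish : ∀ s → s ≢ i → indicator p u s * x s ≡ 0ℚ
  vanish s s≢i with p (at u (toℕ s)) in ps≡
  ... | true  = ⊥-elim (s≢i (Finₚ.toℕ-injective (count≤1-unique p u _ _ p0 count≤1 ps≡ pu≡)))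
  ... | false = ℚ.*-zeroˡ (x s)

m+n≤2+f⇒m≤1+f : ∀ {m n f} → 1 ≤ n → m ℕ.+ n ≤ suc (suc f) → m ≤ suc f
m+n≤2+f⇒m≤1+f {m} 1≤n m+n≤ =
  ℕ.≤-pred (ℕ.≤-trans (ℕ.≤-reflexive (ℕ.+-comm 1 m)) (ℕ.≤-trans (ℕ.+-monoʳ-≤ m 1≤n) m+n≤))

-- The bound on the support of u makes the fuel f of preorder sufficient.
mutual
  preorder-complete : ∀ {n} f u → IsLabel n u → count isPos u ℕ.+ count isNeg u ≤ suc f → (x : Fin n → ℚ) →
                      indicator isNonZero u · x ≡ 0ℚ → All (λ v → ⟦ v ⟧ · x ≡ 0ℚ) (preorder f u) →
                      ∀ i → isNonZero (at u (toℕ i)) ≡ true → x i ≡ 0ℚ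
  preorder-complete zero u L signs≤1 x _ _ i _
    with s≤s () ← ℕ.≤-trans (ℕ.+-mono-≤ (Balanced.hasPos L) (Balanced.hasNeg L)) signs≤1
  preorder-complete (suc f) u L signs≤ x support·x≡0 (u·x≡0 ∷ subtrees⊥x) i nz =
    [ subtree-complete isPos refl f u length≡ pos-fuel x (proj₁ class-sums) (proj₁ subtrees) i
    , subtree-complete isNeg refl f u length≡ neg-fuel x (proj₂ class-sums) (proj₂ subtrees) i
    ]′ (sign-split (at u (toℕ i)) nz)
    where
    open Balanced L
    pos-fuel : count isPos u ≤ suc f
    pos-fuel = m+n≤2+f⇒m≤1+f hasNeg signs≤
    neg-fuel : count isNeg u ≤ suc f
    neg-fuel = m+n≤2+f⇒m≤1+f hasPos (subst (_≤ suc (suc f)) (ℕ.+-comm (count isPos u) (count isNeg u)) signs≤)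
    class-sums : indicator isPos u · x ≡ 0ℚ × indicator isNeg u · x ≡ 0ℚ
    class-sums = label-class-sums L x support·x≡0 u·x≡0
    subtrees : All (λ v → ⟦ v ⟧ · x ≡ 0ℚ) (subtree isPos f u) × All (λ v → ⟦ v ⟧ · x ≡ 0ℚ) (subtree isNeg f u)
    subtrees = All.++⁻ (subtree isPos f u) subtrees⊥x

  subtree-complete : ∀ {n} p → p (+ 0) ≡ false → ∀ f u → length u ≡ n → count p u ≤ suc f → (x : Fin n → ℚ) →
                     indicator p u · x ≡ 0ℚ → All (λ v → ⟦ v ⟧ · x ≡ 0ℚ) (subtree p f u) →
                     ∀ i → p (at u (toℕ i)) ≡ true → x i ≡ 0ℚ
  subtree-complete p p0 f u length≡ count≤ x class·x≡0 subtree⊥x i pu≡ with 2 ≤ᵇ count p u in 2≤ᵇcount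
  ... | true = preorder-complete f (child p u) (child-isLabel p p0 u 2≤count length≡)
                 (ℕ.≤-trans (child-signs≤count p p0 u 2≤count) count≤) x
                 (trans (·-congˡ x (λ j → cong 𝟙 (child-support p p0 u 2≤count (toℕ j)))) class·x≡0)
                 subtree⊥x i (trans (child-support p p0 u 2≤count (toℕ i)) pu≡)
    where
    2≤count : 2 ≤ count p u
    2≤count = ℕ.≤ᵇ⇒≤ 2 (count p u) (subst T (sym 2≤ᵇcount) tt)
  ... | false = trans (sym (indicator-singleton p u p0 count≤1 x i pu≡)) class·x≡0
    where
    count≤1 : count p u ≤ 1
    count≤1 = ℕ.≤-pred (ℕ.≰⇒> (λ 2≤count → subst T 2≤ᵇcount (ℕ.≤⇒≤ᵇ 2≤count)))

label-nondegenerate : ∀ {n u} → IsLabel n u → ⟦_⟧ {n} u · ⟦ u ⟧ ≢ 0ℚ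
label-nondegenerate {n} {u} L u·u≡0 with sumℤ-squares-positive u (Balanced.hasPos L)
... | N , squares≡ with () ← toℚ-injective {+ suc N} {+ 0} (begin
  toℚ (+ suc N)                ≡⟨ cong toℚ squares≡ ⟨
  toℚ (sumℤ (map square u))    ≡⟨ ∑⟦⟧ (map square u) (trans (List.length-map square u) (Balanced.length≡ L)) ⟨
  ∑ {n} ⟦ map square u ⟧       ≡⟨ ∑-cong {n} (λ i → trans (cong toℚ (at-map square u (toℕ i) refl))
                                                          (toℚ-* (at u (toℕ i)) (at u (toℕ i)))) ⟩
  ⟦_⟧ {n} u · ⟦ u ⟧            ≡⟨ u·u≡0 ⟩
  0ℚ                           ∎)

-- U(n)

All-lookupL : ∀ {P : List ℤ → Set} {xs} → All P xs → ∀ q → P (lookupL xs q)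
All-lookupL (Px ∷ Pxs) zero    = Px
All-lookupL (Px ∷ Pxs) (suc q) = All-lookupL Pxs q

lookupL-All : ∀ {P : List ℤ → Set} xs → (∀ q → P (lookupL xs q)) → All P xs
lookupL-All []       P-lookup = []
lookupL-All (x ∷ xs) P-lookup = P-lookup zero ∷ lookupL-All xs (P-lookup ∘ suc)

AllPairs-lookupL : ∀ {R : List ℤ → List ℤ → Set} {xs} → (∀ {x y} → R x y → R y x) → AllPairs R xs →
                   ∀ q q′ → q ≢ q′ → R (lookupL xs q) (lookupL xs q′)
AllPairs-lookupL sym-R (Rx ∷ Rxs) zero    zero     q≢q′ = ⊥-elim (q≢q′ refl)
AllPairs-lookupL sym-R (Rx ∷ Rxs) zero    (suc q′) q≢q′ = All-lookupL Rx q′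
AllPairs-lookupL sym-R (Rx ∷ Rxs) (suc q) zero     q≢q′ = sym-R (All-lookupL Rx q)
AllPairs-lookupL sym-R (Rx ∷ Rxs) (suc q) (suc q′) q≢q′ = AllPairs-lookupL sym-R Rxs q q′ (q≢q′ ∘ cong suc)

U-isOrthogonalBasisOfSumZero : ∀ n → 2 ≤ n → IsOrthogonalBasisOfSumZero (λ q → ⟦_⟧ {n} (lookupL (U n) q))
U-isOrthogonalBasisOfSumZero n 2≤n = record
  { sum≡0         = λ q → trans (∑⟦⟧ (lookupL (U n) q) (Balanced.length≡ (label q)))
                                (cong toℚ (Balanced.sum≡0 (label q)))
  ; orthogonal    = AllPairs-lookupL (λ {v} {v′} → trans (·-comm {n} ⟦ v′ ⟧ ⟦ v ⟧))
                                     (preorder-orthogonal n (w n) root)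
  ; nondegenerate = λ q → label-nondegenerate (label q)
  ; complete      = λ x ∑x≡0 U⊥x i →
      preorder-complete n (w n) root signs≤ x (trans (support·x≡∑x x) ∑x≡0) (lookupL-All (U n) U⊥x)
                        i (root-nonzero i)
  }
  where
  W : IsWeight n (w n)
  W = w-isWeight n 2≤n
  root : IsLabel n (w n)
  root = IsWeight⇒IsLabel W
  label : ∀ q → IsLabel n (lookupL (U n) q)
  label = All-lookupL (preorder-isLabel n (w n) root)
  root-nonzero : ∀ (i : Fin n) → isNonZero (at (w n) (toℕ i)) ≡ true
  root-nonzero = at-All (w n) (All.map TwoValued⇒isNonZero (Balanced.entries W)) (Balanced.length≡ W)
  signs≤ : count isPos (w n) ℕ.+ count isNeg (w n) ≤ suc n
  signs≤ = ℕ.≤-trans (count-isPos+isNeg≤length (w n))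
                     (ℕ.≤-trans (ℕ.≤-reflexive (Balanced.length≡ W)) (ℕ.n≤1+n n))
  support·x≡∑x : ∀ x → indicator isNonZero (w n) · x ≡ ∑ x
  support·x≡∑x x = ∑-cong (λ i → trans (cong (λ β → 𝟙 β * x i) (root-nonzero i)) (ℚ.*-identityˡ (x i)))

Bmn-entries : ∀ m n t i j → Bmn m n t i j ≡
                              ⟦ lookupL (U m) (proj₁ (Fin.remQuot {length (U m)} (length (U n)) t)) ⟧ i
                            * ⟦ lookupL (U n) (proj₂ (Fin.remQuot {length (U m)} (length (U n)) t)) ⟧ j
Bmn-entries m n t i j = toℚ-* (at (lookupL (U m) _) (toℕ i)) (at (lookupL (U n) _) (toℕ j))

theorem1 : (m n : ℕ) → m ≥ 2 → n ≥ 2 → IsOrthogonalBasisOfV (Bmn m n)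
theorem1 m n m≥2 n≥2 =
  outer-isOrthogonalBasisOfV (U-isOrthogonalBasisOfSumZero m m≥2) (U-isOrthogonalBasisOfSumZero n n≥2)
                             (Bmn m n) (Bmn-entries m n)
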